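{- Let $D$ be finite, $r\in\mathbb{N}$, $R\subseteq D^r$, $\overline{R}=D^r\setminus R$ and $n\in\mathbb{N}$. Then \[ \operatorname{CL}(\overline{R},n)-1=\max_{\Psi}\operatorname{CL}(C_{R,\Psi}), \] where the maximum ranges over all instances $\Psi$ of $\operatorname{CSP}(R)$ on $n$ variables.
   Context: An instance $\Psi=(X,Y)$ of $\operatorname{CSP}(P)$ has a finite variable set $X$ and clauses $Y\subseteq X^r$; for $\sigma:X\to D$, $\sigma(y)=(\sigma(y_1),\dots,\sigma(y_r))$, and $\operatorname{sat}(P,\Psi)$ is the set of $\sigma$ with $\sigma(y)\in P$ for all $y\in Y$. For predicates: a chain is a sequence of instances $\Psi_1,\dots,\Psi_\ell$ of $\operatorname{CSP}(P)$ on a common variable set of size $n$ with $\operatorname{sat}(P,\Psi_1)\subsetneq\cdots\subsetneq\operatorname{sat}(P,\Psi_\ell)$, and $\operatorname{CL}(P,n)$ is the maximum such $\ell$. The satisfiability code $C_{R,\Psi}\subseteq\{0,1\}^Y$ consists of the words $c_\sigma$, $\sigma:X\to D$, with $c_{\sigma,y}=\mathbf 1[\sigma(y)\in R]$. For a code $C\subseteq\{0,1\}^Y$: a chain of length $\ell$ is a pair of injective maps $a:[\ell]\to Y$, $c:[\ell]\to C$ with $c(i)_{a(i)}=1$ for all $i$ and $c(j)_{a(i)}=0$ for all $1\le i<j\le\ell$; $\operatorname{CL}(C)$ is the maximum length of a chain. -}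

module Defs where

open import Data.Nat using (ℕ; suc; _≤_)
open import Data.Fin using (Fin; toℕ; _<_)
open import Data.Vec using (Vec; map)
open import Data.Bool using (Bool; true; false; not; T)
open import Data.Product using (Σ; ∃; _×_; _,_)
open import Relation.Binary.PropositionalEquality using (_≡_)
open import Relation.Nullary using (¬_)

-- Domain D = Fin d (a finite set).  A relation/predicate P ⊆ D^r is a
-- Boolean-valued predicate on r-tuples.
Rel : ℕ → ℕ → Set
Rel d r = Vec (Fin d) r → Bool

compl : ∀ {d r} → Rel d r → Rel d r
compl R t = not (R t)

-- An instance of CSP(P) on the variable set X = Fin n (|X| = n) with arity r:
-- the set of clauses Y ⊆ X^r, given as a Boolean predicate on r-tuples.
Instance : ℕ → ℕ → Set
Instance n r = Vec (Fin n) r → Bool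

Clause : ∀ {n r} → Instance n r → Set
Clause {n} {r} Ψ = Σ (Vec (Fin n) r) (λ y → T (Ψ y))

apply : ∀ {n d r} → (Fin n → Fin d) → Vec (Fin n) r → Vec (Fin d) r
apply σ y = map σ y

sat : ∀ {d r n} → Rel d r → Instance n r → (Fin n → Fin d) → Set
sat P Ψ σ = ∀ y → T (Ψ y) → T (P (apply σ y))

_⊊_ : ∀ {A : Set} → (A → Set) → (A → Set) → Set
S ⊊ S' = (∀ a → S a → S' a) × ∃ (λ a → S' a × ¬ S a)

HasChain : ∀ {d r} → Rel d r → ℕ → ℕ → Set
HasChain {d} {r} P n ℓ =
  Σ (Fin ℓ → Instance n r) λ Ψs →
    ∀ (i j : Fin ℓ) → toℕ j ≡ suc (toℕ i) → sat P (Ψs i) ⊊ sat P (Ψs j)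

IsMax : (ℕ → Set) → ℕ → Set
IsMax S m = S m × (∀ k → S k → k ≤ m)

IsCL : ∀ {d r} → Rel d r → ℕ → ℕ → Set
IsCL P n ℓ = IsMax (HasChain P n) ℓ

Code : Set → Set₁
Code Y = (Y → Bool) → Set

-- A chain of length ℓ in C: injective a : [ℓ] → Y, injective c : [ℓ] → C
-- (injectivity of c w.r.t. equality of words, i.e. coordinatewise),
-- c(i)_{a(i)} = 1, and c(j)_{a(i)} = 0 for i < j.
HasCodeChain : ∀ {Y : Set} → Code Y → ℕ → Set
HasCodeChain {Y} C ℓ =
  Σ (Fin ℓ → Y) λ a → Σ (Fin ℓ → (Y → Bool)) λ c →
    (∀ i → C (c i)) ×
    (∀ i j → a i ≡ a j → i ≡ j) ×
    (∀ i j → (∀ y → c i y ≡ c j y) → i ≡ j) ×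
    (∀ i → c i (a i) ≡ true) ×
    (∀ i j → i < j → c j (a i) ≡ false)

IsCodeCL : ∀ {Y : Set} → Code Y → ℕ → Set
IsCodeCL C m = IsMax (HasCodeChain C) m

satCode : ∀ {d r n} → Rel d r → (Ψ : Instance n r) → Code (Clause Ψ)
satCode {d} {r} {n} R Ψ w =
  ∃ λ (σ : Fin n → Fin d) → ∀ (y : Clause Ψ) → w y ≡ R (apply σ (Data.Product.proj₁ y))

{-# OPTIONS --safe #-}
module Submission where

-- Both kinds of chain encode the same object, a triangular system: assignments
-- σ₀ … σₘ₋₁ and tuples y₀ … yₘ₋₁ with σᵢ(yᵢ) ∈ R and σⱼ(yᵢ) ∉ R for j < i.
-- Given one, the instances Ψₖ = {yᵢ : k ≤ i} (k = 0 … m) form a chain of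
-- length m + 1 for R̄, the step from Ψₖ to Ψₖ₊₁ being witnessed by σₖ.
-- Conversely, an assignment σₖ in sat(R̄, Ψₖ₊₁) ∖ sat(R̄, Ψₖ) sends some clause
-- yₖ of Ψₖ into R, and monotonicity of the chain makes the system triangular.
-- Read backwards, a triangular system is a chain of length m in C_{R,Ψ} for any
-- Ψ containing the yᵢ, with words c_{σᵢ}.  So the code of the instance whose
-- clauses are all r-tuples attains CL(R̄, n) − 1, and no instance exceeds it.
-- All maxima exist because the search spaces are finite.

open import Defs
open import Data.Nat using (ℕ; zero; suc; _∸_; _^_; z≤n; s≤s; s≤s⁻¹)
import Data.Nat as ℕ
open import Data.Nat.Properties using (n≤0⇒n≡0; ≤∧≢⇒<; ≤-pred; ≤-reflexive; <⇒≤; ∸-monoʳ-<)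
open import Data.Fin using (Fin; suc; toℕ; fromℕ<; inject₁; opposite; funToFin; finToFun; _<_; _≤_; _≤?_; _<?_)
open import Data.Fin.Properties
  using (any?; all?; <-cmp; injective⇒≤; toℕ<n; toℕ-fromℕ<; toℕ-inject₁; opposite-prop; finToFun-funToFin)
  renaming (_≟_ to _≟ᶠ_)
open import Data.Fin.Induction using (<-weakInduction-startingFrom)
open import Data.Vec using (Vec; []; _∷_; lookup; tabulate)
open import Data.Vec.Properties using (map-cong; lookup∘tabulate; tabulate∘lookup; tabulate-cong; ≡-dec)
open import Data.Bool using (Bool; true; false; T)
open import Data.Bool.Properties using (T-not-≡; T-irrelevant; not-injective; not-¬) renaming (_≟_ to _≟ᵇ_)
open import Data.Unit using (tt)
open import Data.Product using (Σ; ∃; ∃₂; _×_; _,_; proj₁; proj₂)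
open import Function using (_∘_; Injective)
open import Function.Bundles using (Equivalence)
open import Relation.Nullary using (¬_; Dec; yes; no; contradiction)
open import Relation.Nullary.Decidable using (isYes; map′; _×-dec_; _→-dec_; T?; toWitness; fromWitness)
open import Relation.Unary using (Decidable)
open import Relation.Binary using (tri<; tri≈; tri>)
open import Relation.Binary.PropositionalEquality using (_≡_; refl; sym; trans; cong; subst; subst₂; _≗_; module ≡-Reasoning)

Searchable : Set → Set₁
Searchable A = (P : A → Set) → Decidable P → Dec (∃ P)

Fin-searchable : ∀ k → Searchable (Fin k)
Fin-searchable k P P? = any? P?

Vec-searchable : ∀ {A} → Searchable A → ∀ k → Searchable (Vec A k)
Vec-searchable search zero P P? with P? []
... | yes p = yes ([] , p)
... | no ¬p = no λ { ([] , p) → ¬p p }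
Vec-searchable search (suc k) P P? with search (λ a → ∃ (P ∘ (a ∷_)))
                                       (λ a → Vec-searchable search k (P ∘ (a ∷_)) (P? ∘ (a ∷_)))
... | yes (a , v , p) = yes (a ∷ v , p)
... | no ¬p = no λ { (a ∷ v , p) → ¬p (a , v , p) }

bounded⇒∃max : ∀ {S : ℕ → Set} → Decidable S → ∀ B → (∀ k → S k → k ℕ.≤ B) →
               ∀ {k₀} → S k₀ → ∃ (IsMax S)
bounded⇒∃max {S} S? zero ≤0 s₀ = 0 , subst S (n≤0⇒n≡0 (≤0 _ s₀)) s₀ , ≤0
bounded⇒∃max {S} S? (suc B) ≤1+B s₀ with S? (suc B)
... | yes s = suc B , s , ≤1+B
... | no ¬s = bounded⇒∃max S? B ≤B s₀
  where
  ≤B : ∀ k → S k → k ℕ.≤ B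
  ≤B k sk = ≤-pred (≤∧≢⇒< (≤1+B k sk) λ { refl → ¬s sk })

opposite-< : ∀ {m} {i j : Fin m} → i < j → opposite j < opposite i
opposite-< {i = i} {j} i<j =
  subst₂ ℕ._<_ (sym (opposite-prop j)) (sym (opposite-prop i)) (∸-monoʳ-< (s≤s i<j) (toℕ<n j))

chain-⊆ : ∀ {A : Set} {m} (S : Fin (suc m) → A → Set) →
          (∀ i j → toℕ j ≡ suc (toℕ i) → ∀ a → S i a → S j a) →
          ∀ {i j} → i ≤ j → ∀ a → S i a → S j a
chain-⊆ S step {i} = <-weakInduction-startingFrom (λ j → ∀ a → S i a → S j a) (λ _ s → s) extend
  where
  extend : ∀ j → (∀ a → S i a → S (inject₁ j) a) → ∀ a → S i a → S (suc j) a
  extend j S⊆ a = step (inject₁ j) (suc j) (cong suc (sym (toℕ-inject₁ j))) a ∘ S⊆ a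

module _ {Y : Set} {m : ℕ} {a : Fin m → Y} {c : Fin m → Y → Bool}
         (hits : ∀ i → c i (a i) ≡ true) (misses : ∀ i j → i < j → c j (a i) ≡ false) where

  unitriangular⇒a-injective : ∀ i j → a i ≡ a j → i ≡ j
  unitriangular⇒a-injective i j eq with <-cmp i j
  ... | tri< i<j _ _ = contradiction (misses i j i<j) (not-¬ (trans (cong (c j) eq) (hits j)))
  ... | tri≈ _ i≡j _ = i≡j
  ... | tri> _ _ j<i = contradiction (misses j i j<i) (not-¬ (trans (cong (c i) (sym eq)) (hits i)))

  unitriangular⇒c-injective : ∀ i j → (∀ y → c i y ≡ c j y) → i ≡ j
  unitriangular⇒c-injective i j eq with <-cmp i j
  ... | tri< i<j _ _ = contradiction (misses i j i<j) (not-¬ (trans (sym (eq (a i))) (hits i)))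
  ... | tri≈ _ i≡j _ = i≡j
  ... | tri> _ _ j<i = contradiction (misses j i j<i) (not-¬ (trans (eq (a j)) (hits j)))

codeChain-zero : ∀ {Y} {C : Code Y} → HasCodeChain C 0
codeChain-zero = (λ ()) , (λ ()) , (λ ()) , (λ ()) , (λ ()) , (λ ()) , (λ ())

codeChain-length≤ : ∀ {Y} {C : Code Y} {m N} (f : Y → Fin N) → Injective _≡_ _≡_ f →
                    HasCodeChain C m → m ℕ.≤ N
codeChain-length≤ f f-injective (a , _ , _ , a-injective , _) =
  injective⇒≤ {f = f ∘ a} (a-injective _ _ ∘ f-injective)

funToFin∘lookup-injective : ∀ {n r} {u v : Vec (Fin n) r} →
                            funToFin (lookup u) ≡ funToFin (lookup v) → u ≡ v
funToFin∘lookup-injective {u = u} {v} eq = begin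
  u                   ≡⟨ tabulate∘lookup u ⟨
  tabulate (lookup u) ≡⟨ tabulate-cong lookup-equal ⟩
  tabulate (lookup v) ≡⟨ tabulate∘lookup v ⟩
  v                   ∎
  where
  open ≡-Reasoning
  lookup-equal : lookup u ≗ lookup v
  lookup-equal i = begin
    lookup u i                         ≡⟨ finToFun-funToFin (lookup u) i ⟨
    finToFun (funToFin (lookup u)) i   ≡⟨ cong (λ k → finToFun k i) eq ⟩
    finToFun (funToFin (lookup v)) i   ≡⟨ finToFun-funToFin (lookup v) i ⟩
    lookup v i                         ∎

clauseCodeChain-length≤ : ∀ {n r} {Ψ : Instance n r} {C : Code (Clause Ψ)} {m} →
                          HasCodeChain C m → m ℕ.≤ n ^ r
clauseCodeChain-length≤ {C = C} =
  codeChain-length≤ {C = C} (funToFin ∘ lookup ∘ proj₁) clause-injective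
  where
  clause-injective : Injective _≡_ _≡_ (funToFin ∘ lookup ∘ proj₁)
  clause-injective {t , p} {t′ , q} eq with refl ← funToFin∘lookup-injective {u = t} {t′} eq =
    cong (t ,_) (T-irrelevant p q)

allClauses : ∀ {n r} → Instance n r
allClauses _ = true

suffixClauses : ∀ {n r m} → (Fin m → Vec (Fin n) r) → Fin (suc m) → Instance n r
suffixClauses y k t = isYes (any? λ q → (k ≤? q) ×-dec ≡-dec _≟ᶠ_ (y q) t)

sat-antitone : ∀ {d r n} {P : Rel d r} {Ψ Ψ′ : Instance n r} →
               (∀ t → T (Ψ′ t) → T (Ψ t)) → ∀ σ → sat P Ψ σ → sat P Ψ′ σ
sat-antitone Ψ′⊆Ψ σ σ-sat t t∈Ψ′ = σ-sat t (Ψ′⊆Ψ t t∈Ψ′)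

unsat⇒violated : ∀ {d r n} (P : Rel d r) {Ψ : Instance n r} {σ : Fin n → Fin d} →
                 ¬ sat P Ψ σ → ∃ λ t → T (Ψ t) × P (apply σ t) ≡ false
unsat⇒violated {n = n} P {Ψ} {σ} σ-unsat
  with Vec-searchable (Fin-searchable n) _ _ (λ t → T? (Ψ t) ×-dec (P (apply σ t) ≟ᵇ false))
... | yes violated = violated
... | no ¬violated = contradiction σ-sat σ-unsat
  where
  σ-sat : sat P Ψ σ
  σ-sat t t∈Ψ with P (apply σ t) in eq
  ... | true  = tt
  ... | false = contradiction (t , t∈Ψ , eq) ¬violated

module _ {d r n : ℕ} (R : Rel d r) where

  record IsTriangular (Ψ : Instance n r) {m : ℕ}
                      (σ : Fin m → Fin n → Fin d) (y : Fin m → Vec (Fin n) r) : Set where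
    constructor mkIsTriangular
    field
      clauses      : ∀ i → T (Ψ (y i))
      hits         : ∀ i → R (apply (σ i) (y i)) ≡ true
      misses-later : ∀ i j → j < i → R (apply (σ j) (y i)) ≡ false

  record Triangular (Ψ : Instance n r) (m : ℕ) : Set where
    field
      σ            : Fin m → Fin n → Fin d
      y            : Fin m → Vec (Fin n) r
      isTriangular : IsTriangular Ψ σ y
    open IsTriangular isTriangular public

  isTriangular? : ∀ Ψ {m} σ y → Dec (IsTriangular Ψ {m} σ y)
  isTriangular? Ψ σ y =
    map′ (λ (c , h , l) → mkIsTriangular c h l)
         (λ t → IsTriangular.clauses t , IsTriangular.hits t , IsTriangular.misses-later t)
         (all? (T? ∘ Ψ ∘ y) ×-dec
          all? (λ i → R (apply (σ i) (y i)) ≟ᵇ true) ×-dec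
          all? (λ i → all? λ j → (j <? i) →-dec (R (apply (σ j) (y i)) ≟ᵇ false)))

  IsTriangular-cong : ∀ {Ψ m} {σ σ′ : Fin m → Fin n → Fin d} {y y′ : Fin m → Vec (Fin n) r} →
                      (∀ i → σ i ≗ σ′ i) → y ≗ y′ → IsTriangular Ψ σ y → IsTriangular Ψ σ′ y′
  IsTriangular-cong {Ψ} {σ = σ} {σ′} {y} {y′} σ≗σ′ y≗y′ t = mkIsTriangular
    (λ i → subst (T ∘ Ψ) (y≗y′ i) (clauses i))
    (λ i → trans (sym (entry≡ i i)) (hits i))
    (λ i j j<i → trans (sym (entry≡ i j)) (misses-later i j j<i))
    where
    open IsTriangular t
    entry≡ : ∀ i j → R (apply (σ j) (y i)) ≡ R (apply (σ′ j) (y′ i))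
    entry≡ i j = cong R (trans (map-cong (σ≗σ′ j) (y i)) (cong (apply (σ′ j)) (y≗y′ i)))

  -- Assignments are functions, so the finite search runs over their tables.
  triangular? : ∀ Ψ m → Dec (Triangular Ψ m)
  triangular? Ψ m =
    map′ (λ (_ , _ , t) → record { isTriangular = t }) tabulated
      (Vec-searchable (Vec-searchable (Fin-searchable d) n) m _ λ σs →
       Vec-searchable (Vec-searchable (Fin-searchable n) r) m _ λ ys →
       isTriangular? Ψ (lookup ∘ lookup σs) (lookup ys))
    where
    tabulated : Triangular Ψ m →
                ∃₂ λ σs ys → IsTriangular Ψ (lookup ∘ lookup σs) (lookup ys)
    tabulated t = tabulate (tabulate ∘ σ) , tabulate y ,
                  IsTriangular-cong σ≗ (sym ∘ lookup∘tabulate y) isTriangular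
      where
      open Triangular t
      σ≗ : ∀ i → σ i ≗ lookup (lookup (tabulate (tabulate ∘ σ)) i)
      σ≗ i x = sym (trans (cong (λ v → lookup v x) (lookup∘tabulate (tabulate ∘ σ) i))
                          (lookup∘tabulate (σ i) x))

  codeChain⇒triangular : ∀ {Ψ m} → HasCodeChain (satCode R Ψ) m → Triangular Ψ m
  codeChain⇒triangular {m = m} (a , c , c∈C , _ , _ , c-hits , c-misses) =
    record { σ = σ ; y = y ; isTriangular = mkIsTriangular (proj₂ ∘ a ∘ opposite) hits misses-later }
    where
    σ : Fin m → Fin n → Fin d
    σ = proj₁ ∘ c∈C ∘ opposite
    y : Fin m → Vec (Fin n) r
    y = proj₁ ∘ a ∘ opposite
    hits : ∀ i → R (apply (σ i) (y i)) ≡ true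
    hits i = trans (sym (proj₂ (c∈C (opposite i)) (a (opposite i)))) (c-hits (opposite i))
    misses-later : ∀ i j → j < i → R (apply (σ j) (y i)) ≡ false
    misses-later i j j<i = trans (sym (proj₂ (c∈C (opposite j)) (a (opposite i))))
                                 (c-misses (opposite i) (opposite j) (opposite-< j<i))

  triangular⇒codeChain : ∀ {Ψ m} → Triangular Ψ m → HasCodeChain (satCode R Ψ) m
  triangular⇒codeChain {Ψ} {m} t =
    a , c , (λ i → σ (opposite i) , λ _ → refl) ,
    unitriangular⇒a-injective {a = a} {c} c-hits c-misses ,
    unitriangular⇒c-injective {a = a} {c} c-hits c-misses ,
    c-hits , c-misses
    where
    open Triangular t
    a : Fin m → Clause Ψ
    a i = y (opposite i) , clauses (opposite i)
    c : Fin m → Clause Ψ → Bool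
    c i w = R (apply (σ (opposite i)) (proj₁ w))
    c-hits : ∀ i → c i (a i) ≡ true
    c-hits = hits ∘ opposite
    c-misses : ∀ i j → i < j → c j (a i) ≡ false
    c-misses i j i<j = misses-later (opposite i) (opposite j) (opposite-< i<j)

  codeChain? : ∀ Ψ m → Dec (HasCodeChain (satCode R Ψ) m)
  codeChain? Ψ m = map′ triangular⇒codeChain codeChain⇒triangular (triangular? Ψ m)

  triangular⇒chain : ∀ {Ψ m} → Triangular Ψ m → HasChain (compl R) n (suc m)
  triangular⇒chain {m = m} t = suffixClauses y , strict
    where
    open Triangular t
    strict : ∀ i j → toℕ j ≡ suc (toℕ i) →
             sat (compl R) (suffixClauses y i) ⊊ sat (compl R) (suffixClauses y j)
    strict i j j≡1+i = sat-antitone {P = compl R} shrink , σ k , σₖ-sat , σₖ-unsat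
      where
      k : Fin m
      k = fromℕ< (s≤s⁻¹ (subst (ℕ._< suc m) j≡1+i (toℕ<n j)))
      1+k≡j : suc (toℕ k) ≡ toℕ j
      1+k≡j = trans (cong suc (toℕ-fromℕ< _)) (sym j≡1+i)
      shrink : ∀ t → T (suffixClauses y j t) → T (suffixClauses y i t)
      shrink t t∈Ψⱼ with q , j≤q , refl ← toWitness t∈Ψⱼ =
        fromWitness (q , <⇒≤ (subst (ℕ._≤ toℕ q) j≡1+i j≤q) , refl)
      σₖ-sat : sat (compl R) (suffixClauses y j) (σ k)
      σₖ-sat t t∈Ψⱼ with q , j≤q , refl ← toWitness t∈Ψⱼ =
        Equivalence.from T-not-≡ (misses-later q k (subst (ℕ._≤ toℕ q) (sym 1+k≡j) j≤q))
      σₖ-unsat : ¬ sat (compl R) (suffixClauses y i) (σ k)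
      σₖ-unsat σₖ-sat′ = not-¬ (hits k) (Equivalence.to T-not-≡ (σₖ-sat′ (y k) yₖ∈Ψᵢ))
        where
        yₖ∈Ψᵢ : T (suffixClauses y i (y k))
        yₖ∈Ψᵢ = fromWitness (k , ≤-reflexive (sym (toℕ-fromℕ< _)) , refl)

  chain⇒triangular : ∀ {m} → HasChain (compl R) n (suc m) → Triangular allClauses m
  chain⇒triangular {m} (Ψs , strict) =
    record { σ = σ ; y = y ; isTriangular = mkIsTriangular (λ _ → tt) hits misses-later }
    where
    step : ∀ k → sat (compl R) (Ψs (inject₁ k)) ⊊ sat (compl R) (Ψs (suc k))
    step k = strict (inject₁ k) (suc k) (cong suc (sym (toℕ-inject₁ k)))
    σ : Fin m → Fin n → Fin d
    σ k = proj₁ (proj₂ (step k))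
    σₖ-sat : ∀ k → sat (compl R) (Ψs (suc k)) (σ k)
    σₖ-sat k = proj₁ (proj₂ (proj₂ (step k)))
    violated : ∀ k → ∃ λ t → T (Ψs (inject₁ k) t) × compl R (apply (σ k) t) ≡ false
    violated k = unsat⇒violated (compl R) (proj₂ (proj₂ (proj₂ (step k))))
    y : Fin m → Vec (Fin n) r
    y k = proj₁ (violated k)
    hits : ∀ i → R (apply (σ i) (y i)) ≡ true
    hits i = not-injective (proj₂ (proj₂ (violated i)))
    misses-later : ∀ i j → j < i → R (apply (σ j) (y i)) ≡ false
    misses-later i j j<i = Equivalence.to T-not-≡ (σⱼ-sat-Ψᵢ (y i) (proj₁ (proj₂ (violated i))))
      where
      σⱼ-sat-Ψᵢ : sat (compl R) (Ψs (inject₁ i)) (σ j)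
      σⱼ-sat-Ψᵢ = chain-⊆ (sat (compl R) ∘ Ψs) (λ i j e → proj₁ (strict i j e))
                    (subst (suc (toℕ j) ℕ.≤_) (sym (toℕ-inject₁ i)) j<i) (σ j) (σₖ-sat j)

  codeChain⇒chain : ∀ {Ψ m} → HasCodeChain (satCode R Ψ) m → HasChain (compl R) n (suc m)
  codeChain⇒chain = triangular⇒chain ∘ codeChain⇒triangular

  chain⇒codeChain : ∀ {m} → HasChain (compl R) n (suc m) → HasCodeChain (satCode R allClauses) m
  chain⇒codeChain = triangular⇒codeChain ∘ chain⇒triangular

proposition8p11 : (d r : ℕ) (R : Rel d r) (n : ℕ) →
    Σ ℕ λ ℓ →
      IsCL (compl R) n ℓ ×
      (∀ (Ψ : Instance n r) → ∃ λ m → IsCodeCL (satCode R Ψ) m) ×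
      IsMax (λ m → Σ (Instance n r) λ Ψ → IsCodeCL (satCode R Ψ) m) (ℓ ∸ 1)
proposition8p11 d r R n =
  suc M , (longest , chain-length≤) , codeCL , (allClauses , M-isMax) , codeCL≤M
  where
  codeCL : ∀ (Ψ : Instance n r) → ∃ λ m → IsCodeCL (satCode R Ψ) m
  codeCL Ψ = bounded⇒∃max (codeChain? R Ψ) (n ^ r)
               (λ _ → clauseCodeChain-length≤ {C = satCode R Ψ}) (codeChain-zero {C = satCode R Ψ})
  M : ℕ
  M = proj₁ (codeCL allClauses)
  M-isMax : IsCodeCL (satCode R allClauses) M
  M-isMax = proj₂ (codeCL allClauses)
  longest : HasChain (compl R) n (suc M)
  longest = codeChain⇒chain R (proj₁ M-isMax)
  chain-length≤ : ∀ ℓ → HasChain (compl R) n ℓ → ℓ ℕ.≤ suc M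
  chain-length≤ zero    _     = z≤n
  chain-length≤ (suc m) chain = s≤s (proj₂ M-isMax m (chain⇒codeChain R chain))
  codeCL≤M : ∀ m → (Σ (Instance n r) λ Ψ → IsCodeCL (satCode R Ψ) m) → m ℕ.≤ M
  codeCL≤M m (_ , chain , _) = ≤-pred (chain-length≤ (suc m) (codeChain⇒chain R chain))
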